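{- Let $k,n$ be integers with $2\le k\le \frac{n}{6}$. Let $H$ be the graph obtained from three vertex-disjoint complete graphs $A\cong K_{2k-1}$, $B\cong K_{\lceil\frac{n+1}{2}\rceil-k}$ and $D\cong K_{\lfloor\frac{n+1}{2}\rfloor-k}$ by choosing a vertex $u\in V(A)$ and a vertex $v\in V(B)$ and adding the edge $uv$, and, writing $V(A)\setminus\{u\}=\{u_1,\dots,u_{2k-2}\}$, adding for each $i=1,\dots,2k-2$ an edge $u_iw_i$ where $w_i\in V(D)$ (the vertices $w_i$ need not be distinct). Then $H$ does not contain a $[2,k]$-ST.
   Context: All graphs are finite and simple. For an integer $k\ge 2$, a $[2,k]$-ST of a connected graph $G$ is a spanning tree $T$ of $G$ having no vertex whose degree in $T$ lies in $\{2,3,\dots,k\}$. -}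

module Defs where

open import Data.Nat using (ℕ; zero; suc; _+_; _*_; _∸_; _≤_; ⌊_/2⌋; ⌈_/2⌉)
open import Data.Bool using (Bool; true; false; not; _∧_; if_then_else_)
open import Data.Fin using (Fin; zero; suc; splitAt; inject₁; fromℕ)
open import Data.Fin.Properties using (_≟_)
open import Data.Sum using (_⊎_; inj₁; inj₂)
import Data.Sum as Sum
open import Data.List using (List; map; allFin)
open import Data.Nat.ListAction using (sum)
open import Data.Product using (_×_; Σ)
open import Function.Definitions using (Injective)
open import Relation.Binary.PropositionalEquality using (_≡_)
open import Relation.Binary.Construct.Closure.ReflexiveTransitive using (Star)
open import Relation.Nullary using (¬_)
open import Relation.Nullary.Decidable using (⌊_⌋)

Graph : ℕ → Set
Graph N = Fin N → Fin N → Bool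

Adj : ∀ {N} → Graph N → Fin N → Fin N → Set
Adj G x y = G x y ≡ true

IsSimple : ∀ {N} → Graph N → Set
IsSimple G = (∀ x y → G x y ≡ G y x) × (∀ x → G x x ≡ false)

degree : ∀ {N} → Graph N → Fin N → ℕ
degree {N} G x = sum (map (λ y → if G x y then 1 else 0) (allFin N))

Connected : ∀ {N} → Graph N → Set
Connected G = ∀ x y → Star (Adj G) x y

record Cycle {N : ℕ} (G : Graph N) : Set where
  field
    len   : ℕ
    vtx   : Fin (suc (suc (suc len))) → Fin N
    inj   : Injective _≡_ _≡_ vtx
    step  : ∀ (i : Fin (suc (suc len))) → Adj G (vtx (inject₁ i)) (vtx (suc i))
    close : Adj G (vtx (fromℕ (suc (suc len)))) (vtx zero)

Acyclic : ∀ {N} → Graph N → Set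
Acyclic G = ¬ Cycle G

IsSpanningTree : ∀ {N} → Graph N → Graph N → Set
IsSpanningTree G T =
  IsSimple T × (∀ x y → Adj T x y → Adj G x y) × Connected T × Acyclic T

Is2kST : ∀ {N} → ℕ → Graph N → Graph N → Set
Is2kST k G T =
  IsSpanningTree G T × (∀ x → ¬ ((2 ≤ degree T x) × (degree T x ≤ k)))

Has2kST : ∀ {N} → ℕ → Graph N → Set
Has2kST k G = Σ (Graph _) (λ T → Is2kST k G T)

sizeA : ℕ → ℕ
sizeA k = 2 * k ∸ 1

sizeB : ℕ → ℕ → ℕ
sizeB n k = ⌈ (n + 1) /2⌉ ∸ k

sizeD : ℕ → ℕ → ℕ
sizeD n k = ⌊ (n + 1) /2⌋ ∸ k

neq : ∀ {m} → Fin m → Fin m → Bool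
neq i j = not ⌊ i ≟ j ⌋

eqb : ∀ {m} → Fin m → Fin m → Bool
eqb i j = ⌊ i ≟ j ⌋

-- adjacency on the disjoint union A ⊎ (B ⊎ D).
-- u ∈ A, v ∈ B; w assigns to each a ∈ A the D-neighbour w a of a
-- (the value w u is ignored: only the vertices a ≠ u get such an edge).
Hsum : ∀ {a b d} → Fin a → Fin b → (Fin a → Fin d) →
       Fin a ⊎ (Fin b ⊎ Fin d) → Fin a ⊎ (Fin b ⊎ Fin d) → Bool
Hsum u v w (inj₁ i)        (inj₁ j)        = neq i j
Hsum u v w (inj₂ (inj₁ i)) (inj₂ (inj₁ j)) = neq i j
Hsum u v w (inj₂ (inj₂ i)) (inj₂ (inj₂ j)) = neq i j
Hsum u v w (inj₁ i)        (inj₂ (inj₁ j)) = eqb i u ∧ eqb j v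
Hsum u v w (inj₂ (inj₁ j)) (inj₁ i)        = eqb i u ∧ eqb j v
Hsum u v w (inj₁ i)        (inj₂ (inj₂ j)) = neq i u ∧ eqb (w i) j
Hsum u v w (inj₂ (inj₂ j)) (inj₁ i)        = neq i u ∧ eqb (w i) j
Hsum u v w (inj₂ (inj₁ _)) (inj₂ (inj₂ _)) = false
Hsum u v w (inj₂ (inj₂ _)) (inj₂ (inj₁ _)) = false

toSum : ∀ a b d → Fin (a + (b + d)) → Fin a ⊎ (Fin b ⊎ Fin d)
toSum a b d x = Sum.map₂ (splitAt b) (splitAt a x)

-- H on vertex set Fin (|A| + (|B| + |D|)) = Fin n
H : (k n : ℕ) → Fin (sizeA k) → Fin (sizeB n k) → (Fin (sizeA k) → Fin (sizeD n k)) →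
    Graph (sizeA k + (sizeB n k + sizeD n k))
H k n u v w x y =
  Hsum u v w (toSum (sizeA k) (sizeB n k) (sizeD n k) x)
             (toSum (sizeA k) (sizeB n k) (sizeD n k) y)

-- The edge uv is the only edge of H leaving B, so a T-path from D to B ends with u v
-- and has u as an interior vertex; a T-path from B to D enters D from a vertex s ≠ u
-- of A, again an interior vertex.  Hence u and s have T-degree at least 2, so at
-- least k + 1.  Every vertex of A has a single H-neighbour outside A, so u and s
-- have at least k T-neighbours inside A, which has only 2k − 1 vertices.  If us is
-- an edge of T they therefore share a neighbour (a triangle), and otherwise they
-- share two neighbours (a 4-cycle); either way T is not a tree.
module Submission where

open import Defs
open import Data.Nat using (ℕ; _≤_; _*_)
open import Data.Fin using (Fin)
open import Relation.Nullary using (¬_)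

open import Data.Nat using (zero; suc; _+_; _<_; z≤n; s≤s)
open import Data.Nat.Properties
open import Algebra.Properties.CommutativeSemigroup +-commutativeSemigroup using (interchange)
open import Data.Nat.ListAction using (sum)
open import Data.Bool using (Bool; true; false; not; _∧_; _∨_; if_then_else_)
open import Data.Bool.Properties using (∧-identityʳ; ∧-zeroʳ)
open import Data.Fin using (zero; suc; _↑ˡ_; _↑ʳ_; splitAt; join; inject₁)
import Data.Fin.Properties as Fin
open import Data.Sum using (_⊎_; inj₁; inj₂)
import Data.Sum as Sum
open import Data.Product using (∃-syntax; _×_; _,_; proj₁; proj₂)
open import Data.Empty using (⊥)
open import Data.List using (map; tabulate)
open import Function using (_∘_)
open import Function.Definitions using (Injective)
open import Relation.Binary.PropositionalEquality
open import Relation.Binary.Construct.Closure.ReflexiveTransitive using (Star; ε; _◅_)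
open import Relation.Nullary using (yes; no; contradiction)

∧-true : ∀ {b c} → b ∧ c ≡ true → b ≡ true × c ≡ true
∧-true {true} {true} _ = refl , refl

∧-intro : ∀ {b c} → b ≡ true → c ≡ true → b ∧ c ≡ true
∧-intro refl refl = refl

not-true : ∀ {b} → not b ≡ true → b ≡ false
not-true {false} _ = refl

eqb-refl : ∀ {m} (i : Fin m) → eqb i i ≡ true
eqb-refl i with i Fin.≟ i
... | yes _ = refl
... | no i≢i = contradiction refl i≢i

eqb⇒≡ : ∀ {m} {i j : Fin m} → eqb i j ≡ true → i ≡ j
eqb⇒≡ {i = i} {j} h with i Fin.≟ j
... | yes i≡j = i≡j

neq⇒≢ : ∀ {m} {i j : Fin m} → neq i j ≡ true → i ≢ j
neq⇒≢ {i = i} {j} h with i Fin.≟ j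
... | no i≢j = i≢j

≢⇒neq : ∀ {m} {i j : Fin m} → i ≢ j → neq i j ≡ true
≢⇒neq {i = i} {j} i≢j with i Fin.≟ j
... | yes i≡j = contradiction i≡j i≢j
... | no _ = refl

-- Counting the elements of Fin N satisfying a Boolean predicate

indicator : Bool → ℕ
indicator b = if b then 1 else 0

count : ∀ {N} → (Fin N → Bool) → ℕ
count {zero}  f = 0
count {suc N} f = indicator (f zero) + count (f ∘ suc)

sum-tabulate-indicator : ∀ {N} {X : Set} (g : X → Bool) (h : Fin N → X) →
  sum (map (λ y → if g y then 1 else 0) (tabulate h)) ≡ count (g ∘ h)
sum-tabulate-indicator {zero}  g h = refl
sum-tabulate-indicator {suc N} g h =
  cong (indicator (g (h zero)) +_) (sum-tabulate-indicator g (h ∘ suc))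

degree≡count : ∀ {N} (G : Graph N) x → degree G x ≡ count (G x)
degree≡count G x = sum-tabulate-indicator (G x) (λ i → i)

count-cong : ∀ {N} {f g : Fin N → Bool} → (∀ i → f i ≡ g i) → count f ≡ count g
count-cong {zero}  f≗g = refl
count-cong {suc N} f≗g = cong₂ _+_ (cong indicator (f≗g zero)) (count-cong (f≗g ∘ suc))

count-false : ∀ {N} {f : Fin N → Bool} → (∀ i → f i ≡ false) → count f ≡ 0
count-false {zero}  f≗false = refl
count-false {suc N} f≗false rewrite f≗false zero = count-false (f≗false ∘ suc)

count-true : ∀ {N} {f : Fin N → Bool} → (∀ i → f i ≡ true) → count f ≡ N
count-true {zero}  f≗true = refl
count-true {suc N} f≗true rewrite f≗true zero = cong suc (count-true (f≗true ∘ suc))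

indicator-mono : ∀ {b c} → (b ≡ true → c ≡ true) → indicator b ≤ indicator c
indicator-mono {false} b⇒c = z≤n
indicator-mono {true}  b⇒c rewrite b⇒c refl = ≤-refl

count-mono : ∀ {N} {f g : Fin N → Bool} →
  (∀ i → f i ≡ true → g i ≡ true) → count f ≤ count g
count-mono {zero}  f⊆g = z≤n
count-mono {suc N} f⊆g = +-mono-≤ (indicator-mono (f⊆g zero)) (count-mono (f⊆g ∘ suc))

count-∨-∧ : ∀ {N} (f g : Fin N → Bool) →
  count f + count g ≡ count (λ i → f i ∨ g i) + count (λ i → f i ∧ g i)
count-∨-∧ {zero}  f g = refl
count-∨-∧ {suc N} f g =
  trans (interchange (indicator (f zero)) _ _ _)
    (trans (cong₂ _+_ (indicator-∨-∧ (f zero) (g zero)) (count-∨-∧ (f ∘ suc) (g ∘ suc)))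
      (interchange (indicator (f zero ∨ g zero)) _ _ _))
  where
  indicator-∨-∧ : ∀ b c → indicator b + indicator c ≡ indicator (b ∨ c) + indicator (b ∧ c)
  indicator-∨-∧ false false = refl
  indicator-∨-∧ false true  = refl
  indicator-∨-∧ true  false = refl
  indicator-∨-∧ true  true  = refl

count-split : ∀ {N} (f g : Fin N → Bool) →
  count f ≡ count (λ i → f i ∧ g i) + count (λ i → f i ∧ not (g i))
count-split {zero}  f g = refl
count-split {suc N} f g =
  trans (cong₂ _+_ (indicator-split (f zero) (g zero)) (count-split (f ∘ suc) (g ∘ suc)))
        (interchange (indicator (f zero ∧ g zero)) _ _ _)
  where
  indicator-split : ∀ b c → indicator b ≡ indicator (b ∧ c) + indicator (b ∧ not c)
  indicator-split false c     = refl
  indicator-split true  false = refl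
  indicator-split true  true  = refl

count-delete : ∀ {N} (f : Fin N → Bool) (z : Fin N) →
  count f ≡ count (λ j → f j ∧ neq z j) + indicator (f z)
count-delete {suc N} f zero = begin
  indicator (f zero) + count (f ∘ suc)
    ≡⟨ +-comm (indicator (f zero)) _ ⟩
  count (f ∘ suc) + indicator (f zero)
    ≡⟨ cong (_+ indicator (f zero)) (cong₂ _+_ (cong indicator (sym (∧-zeroʳ (f zero))))
                                               (count-cong (sym ∘ ∧-identityʳ ∘ f ∘ suc))) ⟩
  (indicator (f zero ∧ false) + count (λ j → f (suc j) ∧ true)) + indicator (f zero) ∎
  where open ≡-Reasoning
count-delete {suc N} f (suc z) = begin
  indicator (f zero) + count (f ∘ suc)
    ≡⟨ cong (indicator (f zero) +_) (count-delete (f ∘ suc) z) ⟩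
  indicator (f zero) + (count (λ j → f (suc j) ∧ neq z j) + indicator (f (suc z)))
    ≡⟨ +-assoc (indicator (f zero)) _ _ ⟨
  (indicator (f zero) + count (λ j → f (suc j) ∧ neq z j)) + indicator (f (suc z))
    ≡⟨ cong (_+ indicator (f (suc z)))
            (cong₂ _+_ (cong indicator (sym (∧-identityʳ (f zero))))
                       (count-cong (λ j → cong (f (suc j) ∧_) (sym (neq-suc j))))) ⟩
  count (λ j → f j ∧ neq (suc z) j) + indicator (f (suc z)) ∎
  where
  open ≡-Reasoning
  neq-suc : ∀ j → neq (suc z) (suc j) ≡ neq z j
  neq-suc j with z Fin.≟ j
  ... | yes _ = refl
  ... | no  _ = refl

count-delete-true : ∀ {N} (f : Fin N → Bool) {z : Fin N} → f z ≡ true →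
  count f ≡ count (λ j → f j ∧ neq z j) + 1
count-delete-true f {z} fz =
  trans (count-delete f z) (cong (λ b → count (λ j → f j ∧ neq z j) + indicator b) fz)

witness⇒1≤count : ∀ {N} (f : Fin N → Bool) {z} → f z ≡ true → 1 ≤ count f
witness⇒1≤count f fz = ≤-trans (m≤n+m 1 _) (≤-reflexive (sym (count-delete-true f fz)))

count-witness : ∀ {N} (f : Fin N → Bool) → 1 ≤ count f → ∃[ i ] f i ≡ true
count-witness {suc N} f 1≤count with f zero in f₀
... | true  = zero , f₀
... | false with count-witness (f ∘ suc) 1≤count
...   | i , fi = suc i , fi

count-two-witnesses : ∀ {N} (f : Fin N → Bool) → 2 ≤ count f →
  ∃[ i ] ∃[ j ] i ≢ j × f i ≡ true × f j ≡ true
count-two-witnesses f 2≤count with count-witness f (≤-trans (s≤s z≤n) 2≤count)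
... | i , fi with count-witness (λ j → f j ∧ neq i j)
                   (+-cancelʳ-≤ 1 1 _ (≤-trans 2≤count (≤-reflexive (count-delete-true f fi))))
...   | j , fj∧i≢j with ∧-true {f j} fj∧i≢j
...     | fj , i≢j = i , j , neq⇒≢ i≢j , fi , fj

two-witnesses⇒2≤count : ∀ {N} (f : Fin N → Bool) {i j} →
  i ≢ j → f i ≡ true → f j ≡ true → 2 ≤ count f
two-witnesses⇒2≤count f {i} i≢j fi fj = begin
  1 + 1
    ≤⟨ +-monoˡ-≤ 1 (witness⇒1≤count (λ k → f k ∧ neq i k) (∧-intro fj (≢⇒neq i≢j))) ⟩
  count (λ k → f k ∧ neq i k) + 1
    ≡⟨ count-delete-true f fi ⟨
  count f ∎
  where open ≤-Reasoning

count-overlap : ∀ {N} {f g r : Fin N → Bool} →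
  (∀ i → f i ≡ true → r i ≡ true) → (∀ i → g i ≡ true → r i ≡ true) →
  count f + count g ≤ count r + count (λ i → f i ∧ g i)
count-overlap {f = f} {g} {r} f⊆r g⊆r = begin
  count f + count g                                  ≡⟨ count-∨-∧ f g ⟩
  count (λ i → f i ∨ g i) + count (λ i → f i ∧ g i)  ≤⟨ +-monoˡ-≤ _ (count-mono f∨g⊆r) ⟩
  count r + count (λ i → f i ∧ g i)                  ∎
  where
  open ≤-Reasoning
  f∨g⊆r : ∀ i → f i ∨ g i ≡ true → r i ≡ true
  f∨g⊆r i fi∨gi with f i in fi
  ... | true  = f⊆r i fi
  ... | false = g⊆r i fi∨gi

count-at-most-one : ∀ {N} (f : Fin N → Bool) (e : Fin N) →
  (∀ j → f j ≡ true → j ≡ e) → count f ≤ 1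
count-at-most-one f e only-e = begin
  count f                                        ≡⟨ count-delete f e ⟩
  count (λ j → f j ∧ neq e j) + indicator (f e)  ≡⟨ cong (_+ indicator (f e)) (count-false none) ⟩
  indicator (f e)                                ≤⟨ indicator≤1 (f e) ⟩
  1                                              ∎
  where
  open ≤-Reasoning
  none : ∀ j → f j ∧ neq e j ≡ false
  none j with f j in fj
  ... | false = refl
  ... | true rewrite only-e j fj = cong not (eqb-refl e)
  indicator≤1 : ∀ b → indicator b ≤ 1
  indicator≤1 false = z≤n
  indicator≤1 true  = ≤-refl

count-↑ : ∀ m n (f : Fin (m + n) → Bool) →
  count f ≡ count (f ∘ (_↑ˡ n)) + count (f ∘ (m ↑ʳ_))
count-↑ zero    n f = refl
count-↑ (suc m) n f = trans (cong (indicator (f zero) +_) (count-↑ m n (f ∘ suc)))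
                            (sym (+-assoc (indicator (f zero)) _ _))

-- Simple and acyclic graphs

two-neighbours⇒2≤degree : ∀ {N} {T : Graph N} {x p q} →
  Adj T x p → Adj T x q → p ≢ q → 2 ≤ degree T x
two-neighbours⇒2≤degree {T = T} {x} xp xq p≢q =
  subst (2 ≤_) (sym (degree≡count T x)) (two-witnesses⇒2≤count (T x) p≢q xp xq)

module _ {N} {T : Graph N} (simple : IsSimple T) where

  adj-sym : ∀ {x y} → Adj T x y → Adj T y x
  adj-sym {x} {y} xy = trans (proj₁ simple y x) xy

  adj⇒≢ : ∀ {x y} → Adj T x y → x ≢ y
  adj⇒≢ {x} xx refl = contradiction (trans (sym xx) (proj₂ simple x)) λ ()

  triangle : ∀ {x y z} → Adj T x y → Adj T y z → Adj T z x → Cycle T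
  triangle {x} {y} {z} xy yz zx = record
    { len = 0 ; vtx = vtx ; inj = inj ; step = step ; close = zx }
    where
    vtx : Fin 3 → Fin N
    vtx zero             = x
    vtx (suc zero)       = y
    vtx (suc (suc zero)) = z
    inj : Injective _≡_ _≡_ vtx
    inj {zero}             {zero}             _ = refl
    inj {zero}             {suc zero}         p = contradiction p (adj⇒≢ xy)
    inj {zero}             {suc (suc zero)}   p = contradiction (sym p) (adj⇒≢ zx)
    inj {suc zero}         {zero}             p = contradiction (sym p) (adj⇒≢ xy)
    inj {suc zero}         {suc zero}         _ = refl
    inj {suc zero}         {suc (suc zero)}   p = contradiction p (adj⇒≢ yz)
    inj {suc (suc zero)}   {zero}             p = contradiction p (adj⇒≢ zx)
    inj {suc (suc zero)}   {suc zero}         p = contradiction (sym p) (adj⇒≢ yz)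
    inj {suc (suc zero)}   {suc (suc zero)}   _ = refl
    step : ∀ i → Adj T (vtx (inject₁ i)) (vtx (suc i))
    step zero       = xy
    step (suc zero) = yz

  square : ∀ {x y z t} → x ≢ z → y ≢ t →
    Adj T x y → Adj T y z → Adj T z t → Adj T t x → Cycle T
  square {x} {y} {z} {t} x≢z y≢t xy yz zt tx = record
    { len = 1 ; vtx = vtx ; inj = inj ; step = step ; close = tx }
    where
    vtx : Fin 4 → Fin N
    vtx zero                   = x
    vtx (suc zero)             = y
    vtx (suc (suc zero))       = z
    vtx (suc (suc (suc zero))) = t
    inj : Injective _≡_ _≡_ vtx
    inj {zero}                   {zero}                   _ = refl
    inj {zero}                   {suc zero}               p = contradiction p (adj⇒≢ xy)
    inj {zero}                   {suc (suc zero)}         p = contradiction p x≢z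
    inj {zero}                   {suc (suc (suc zero))}   p = contradiction (sym p) (adj⇒≢ tx)
    inj {suc zero}               {zero}                   p = contradiction (sym p) (adj⇒≢ xy)
    inj {suc zero}               {suc zero}               _ = refl
    inj {suc zero}               {suc (suc zero)}         p = contradiction p (adj⇒≢ yz)
    inj {suc zero}               {suc (suc (suc zero))}   p = contradiction p y≢t
    inj {suc (suc zero)}         {zero}                   p = contradiction (sym p) x≢z
    inj {suc (suc zero)}         {suc zero}               p = contradiction (sym p) (adj⇒≢ yz)
    inj {suc (suc zero)}         {suc (suc zero)}         _ = refl
    inj {suc (suc zero)}         {suc (suc (suc zero))}   p = contradiction p (adj⇒≢ zt)
    inj {suc (suc (suc zero))}   {zero}                   p = contradiction p (adj⇒≢ tx)
    inj {suc (suc (suc zero))}   {suc zero}               p = contradiction (sym p) y≢t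
    inj {suc (suc (suc zero))}   {suc (suc zero)}         p = contradiction (sym p) (adj⇒≢ zt)
    inj {suc (suc (suc zero))}   {suc (suc (suc zero))}   _ = refl
    step : ∀ i → Adj T (vtx (inject₁ i)) (vtx (suc i))
    step zero             = xy
    step (suc zero)       = yz
    step (suc (suc zero)) = zt

  module _ (acyclic : Acyclic T) where

    common-neighbour-unique : ∀ {x y z z′} → x ≢ y →
      Adj T x z → Adj T y z → Adj T x z′ → Adj T y z′ → z ≡ z′
    common-neighbour-unique {z = z} {z′} x≢y xz yz xz′ yz′ with z Fin.≟ z′
    ... | yes z≡z′ = z≡z′
    ... | no  z≢z′ = contradiction (square x≢y z≢z′ xz (adj-sym yz) yz′ (adj-sym xz′)) acyclic

    -- By inclusion–exclusion in P the neighbourhoods of x and y meet, and when x and y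
    -- are not adjacent both avoid x, so they meet twice: a triangle or a 4-cycle.
    no-two-dense-vertices : ∀ (P : Fin N → Bool) {k} → count P < k + k →
      ∀ {x y} → x ≢ y → P x ≡ true →
      k ≤ count (λ z → T x z ∧ P z) → k ≤ count (λ z → T y z ∧ P z) → ⊥
    no-two-dense-vertices P {k} count-P<2k {x} {y} x≢y Px dense-x dense-y = by-adjacency (T x y) refl
      where
      open ≤-Reasoning
      common : Fin N → Bool
      common z = (T x z ∧ P z) ∧ (T y z ∧ P z)

      common⇒adj : ∀ {z} → common z ≡ true → Adj T x z × Adj T y z
      common⇒adj {z} c with ∧-true {T x z ∧ P z} c
      ... | xz∧Pz , yz∧Pz = proj₁ (∧-true xz∧Pz) , proj₁ (∧-true yz∧Pz)

      2k≤overlap : ∀ {r} → (∀ z → T x z ∧ P z ≡ true → r z ≡ true) →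
        (∀ z → T y z ∧ P z ≡ true → r z ≡ true) → k + k ≤ count r + count common
      2k≤overlap Nx⊆r Ny⊆r = ≤-trans (+-mono-≤ dense-x dense-y) (count-overlap Nx⊆r Ny⊆r)

      1≤common : 1 ≤ count common
      1≤common = +-cancelˡ-< (count P) 0 _ (begin-strict
        count P + 0             ≡⟨ +-identityʳ (count P) ⟩
        count P                 <⟨ count-P<2k ⟩
        k + k                   ≤⟨ 2k≤overlap (λ z → proj₂ ∘ ∧-true {T x z})
                                              (λ z → proj₂ ∘ ∧-true {T y z}) ⟩
        count P + count common  ∎)

      others : Fin N → Bool
      others z = P z ∧ neq x z

      2≤common : T x y ≡ false → 2 ≤ count common
      2≤common x≁y = +-cancelˡ-≤ (count others) 2 _ (begin
        count others + 2             ≡⟨ +-suc (count others) 1 ⟩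
        suc (count others + 1)       ≡⟨ cong suc (count-delete-true P Px) ⟨
        suc (count P)                ≤⟨ count-P<2k ⟩
        k + k                        ≤⟨ 2k≤overlap Nx⊆others Ny⊆others ⟩
        count others + count common  ∎)
        where
        Nx⊆others : ∀ z → T x z ∧ P z ≡ true → others z ≡ true
        Nx⊆others z xz∧Pz with ∧-true {T x z} xz∧Pz
        ... | xz , Pz = ∧-intro Pz (≢⇒neq (adj⇒≢ xz))
        x∉Ny : ∀ {z} → Adj T y z → x ≢ z
        x∉Ny yz refl = contradiction (trans (sym (adj-sym yz)) x≁y) λ ()
        Ny⊆others : ∀ z → T y z ∧ P z ≡ true → others z ≡ true
        Ny⊆others z yz∧Pz with ∧-true {T y z} yz∧Pz
        ... | yz , Pz = ∧-intro Pz (≢⇒neq (x∉Ny yz))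

      by-adjacency : ∀ b → T x y ≡ b → ⊥
      by-adjacency true xy with count-witness common 1≤common
      ... | z , c with common⇒adj c
      ...   | xz , yz = contradiction (triangle xy yz (adj-sym xz)) acyclic
      by-adjacency false x≁y with count-two-witnesses common (2≤common x≁y)
      ... | z , z′ , z≢z′ , c , c′ with common⇒adj c | common⇒adj c′
      ...   | xz , yz | xz′ , yz′ = z≢z′ (common-neighbour-unique x≢y xz yz xz′ yz′)

-- Walks and degrees

record Crossing {N} (T : Graph N) (P : Fin N → Bool) (start : Fin N) : Set where
  field
    source target : Fin N
    edge          : Adj T source target
    source∉P      : P source ≡ false
    target∈P      : P target ≡ true
    entered       : source ≡ start ⊎ ∃[ p ] Adj T p source × P p ≡ false

first-crossing : ∀ {N} {T : Graph N} (P : Fin N → Bool) {x y} →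
  Star (Adj T) x y → P x ≡ false → P y ≡ true → Crossing T P x
first-crossing P ε Px Py = contradiction (trans (sym Px) Py) λ ()
first-crossing {T = T} P {x} (_◅_ {j = z} xz walk) Px Py with P z in Pz
... | true  = record { edge = xz ; source∉P = Px ; target∈P = Pz ; entered = inj₁ refl }
... | false = record { Crossing c hiding (entered) ; entered = inj₂ (entered-via-x (Crossing.entered c)) }
  where
  c : Crossing T P z
  c = first-crossing P walk Pz Py
  entered-via-x : Crossing.source c ≡ z ⊎ ∃[ p ] Adj T p (Crossing.source c) × P p ≡ false →
    ∃[ p ] Adj T p (Crossing.source c) × P p ≡ false
  entered-via-x (inj₁ source≡z) = x , subst (Adj T x) (sym source≡z) xz , Px
  entered-via-x (inj₂ p)        = p

crossing-source-2≤degree : ∀ {N} {T : Graph N} {P x} → IsSimple T →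
  (c : Crossing T P x) → Crossing.source c ≢ x → 2 ≤ degree T (Crossing.source c)
crossing-source-2≤degree {T = T} simple c source≢x with Crossing.entered c
... | inj₁ source≡x = contradiction source≡x source≢x
... | inj₂ (p , ps , Pp) =
  two-neighbours⇒2≤degree {T = T} (adj-sym simple ps) (Crossing.edge c)
    λ { refl → contradiction (trans (sym Pp) (Crossing.target∈P c)) λ () }

many-neighbours-inside : ∀ {N} {G T : Graph N} → (∀ x y → Adj T x y → Adj G x y) →
  (P : Fin N → Bool) → ∀ {x e k} → (∀ y → Adj G x y → P y ≡ false → y ≡ e) →
  suc k ≤ degree T x → k ≤ count (λ z → T x z ∧ P z)
many-neighbours-inside {T = T} T⊆G P {x} {e} {k} outside-is-e k<degree = ≤-pred (begin
  suc k                                                        ≤⟨ k<degree ⟩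
  degree T x                                                   ≡⟨ degree≡count T x ⟩
  count (T x)                                                  ≡⟨ count-split (T x) P ⟩
  count (λ z → T x z ∧ P z) + count (λ z → T x z ∧ not (P z))
    ≤⟨ +-monoʳ-≤ _ (count-at-most-one _ e outside) ⟩
  count (λ z → T x z ∧ P z) + 1                                ≡⟨ +-comm _ 1 ⟩
  suc (count (λ z → T x z ∧ P z))                              ∎)
  where
  open ≤-Reasoning
  outside : ∀ z → T x z ∧ not (P z) ≡ true → z ≡ e
  outside z xz∧¬Pz with ∧-true {T x z} xz∧¬Pz
  ... | xz , ¬Pz = outside-is-e z (T⊆G x z xz) (not-true ¬Pz)

-- The graph H

module StructureOfH {a b d : ℕ} (u : Fin a) (v : Fin b) (w : Fin a → Fin d) where

  Part : Set
  Part = Fin a ⊎ (Fin b ⊎ Fin d)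

  G : Graph (a + (b + d))
  G x y = Hsum u v w (toSum a b d x) (toSum a b d y)

  part : Fin (a + (b + d)) → Part
  part = toSum a b d

  fromPart : Part → Fin (a + (b + d))
  fromPart = join a (b + d) ∘ Sum.map₂ (join b d)

  part-fromPart : ∀ s → part (fromPart s) ≡ s
  part-fromPart (inj₁ i) = cong (Sum.map₂ (splitAt b)) (Fin.splitAt-join a (b + d) (inj₁ i))
  part-fromPart (inj₂ j) =
    trans (cong (Sum.map₂ (splitAt b)) (Fin.splitAt-join a (b + d) (inj₂ (join b d j))))
          (cong inj₂ (Fin.splitAt-join b d j))

  part⇒≡ : ∀ {x s} → part x ≡ s → x ≡ fromPart s
  part⇒≡ {x} refl = sym (trans (cong (join a (b + d)) (map₂-join-splitAt (splitAt a x)))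
                               (Fin.join-splitAt a (b + d) x))
    where
    map₂-join-splitAt : ∀ s → Sum.map₂ (join b d) (Sum.map₂ (splitAt b) s) ≡ s
    map₂-join-splitAt (inj₁ i) = refl
    map₂-join-splitAt (inj₂ j) = cong inj₂ (Fin.join-splitAt b d j)

  inA inB inD : Part → Bool
  inA (inj₁ _)        = true
  inA (inj₂ _)        = false
  inB (inj₂ (inj₁ _)) = true
  inB _               = false
  inD (inj₂ (inj₂ _)) = true
  inD _               = false

  isA isB isD : Fin (a + (b + d)) → Bool
  isA = inA ∘ part
  isB = inB ∘ part
  isD = inD ∘ part

  U V W : Fin (a + (b + d))
  U = fromPart (inj₁ u)
  V = fromPart (inj₂ (inj₁ v))
  -- merely some vertex of D: the edge from u to w u is not in H
  W = fromPart (inj₂ (inj₂ (w u)))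

  part-U : part U ≡ inj₁ u
  part-U = part-fromPart (inj₁ u)

  part-V : part V ≡ inj₂ (inj₁ v)
  part-V = part-fromPart (inj₂ (inj₁ v))

  part-W : part W ≡ inj₂ (inj₂ (w u))
  part-W = part-fromPart (inj₂ (inj₂ (w u)))

  count-A : count isA ≡ a
  count-A = begin
    count isA                                               ≡⟨ count-↑ a (b + d) isA ⟩
    count (λ (i : Fin a) → isA (i ↑ˡ (b + d))) + count (λ j → isA (a ↑ʳ j))
      ≡⟨ cong₂ _+_ (count-true in-A) (count-false in-BD) ⟩
    a + 0                                                   ≡⟨ +-identityʳ a ⟩
    a                                                       ∎
    where
    open ≡-Reasoning
    in-A : ∀ i → isA (i ↑ˡ (b + d)) ≡ true
    in-A i = cong (inA ∘ Sum.map₂ (splitAt b)) (Fin.splitAt-↑ˡ a i (b + d))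
    in-BD : ∀ j → isA (a ↑ʳ j) ≡ false
    in-BD j = cong (inA ∘ Sum.map₂ (splitAt b)) (Fin.splitAt-↑ʳ a (b + d) j)

  edge-leaving-B : ∀ {x y} → Adj G x y → isB x ≡ true → isB y ≡ false → x ≡ V × y ≡ U
  edge-leaving-B {x} {y} xy = leaving (part x) (part y) xy refl refl
    where
    leaving : ∀ s t → Hsum u v w s t ≡ true → part x ≡ s → part y ≡ t →
      inB s ≡ true → inB t ≡ false → x ≡ V × y ≡ U
    leaving (inj₂ (inj₁ j)) (inj₁ i)        st xs yt _ _ with ∧-true {eqb i u} st
    ... | i≡u , j≡v rewrite eqb⇒≡ i≡u | eqb⇒≡ j≡v = part⇒≡ xs , part⇒≡ yt
    leaving (inj₂ (inj₁ j)) (inj₂ (inj₂ _)) () _ _ _ _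
    leaving (inj₂ (inj₁ _)) (inj₂ (inj₁ _)) _ _ _ _ ()
    leaving (inj₁ _)        _               _ _ _ () _
    leaving (inj₂ (inj₂ _)) _               _ _ _ () _

  edge-entering-D : ∀ {x y} → Adj G x y → isD x ≡ false → isD y ≡ true → isA x ≡ true × x ≢ U
  edge-entering-D {x} {y} xy = entering (part x) (part y) xy refl
    where
    entering : ∀ s t → Hsum u v w s t ≡ true → part x ≡ s →
      inD s ≡ false → inD t ≡ true → isA x ≡ true × x ≢ U
    entering (inj₁ i) (inj₂ (inj₂ j)) st xs _ _ = cong inA xs , x≢U
      where
      x≢U : x ≢ U
      x≢U refl with trans (sym xs) part-U
      ... | refl = neq⇒≢ (proj₁ (∧-true {neq i u} st)) refl
    entering (inj₂ (inj₁ _)) (inj₂ (inj₂ _)) () _ _ _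
    entering (inj₂ (inj₂ _)) _               _ _ () _
    entering _               (inj₁ _)        _ _ _ ()
    entering _               (inj₂ (inj₁ _)) _ _ _ ()

  outer-neighbour-unique : ∀ i →
    ∃[ e ] ∀ t → Hsum u v w (inj₁ i) t ≡ true → inA t ≡ false → t ≡ e
  outer-neighbour-unique i with i Fin.≟ u
  ... | yes refl = inj₂ (inj₁ v) , λ where
    (inj₁ _)        _  ()
    (inj₂ (inj₁ j)) it _ → cong (inj₂ ∘ inj₁) (eqb⇒≡ (proj₂ (∧-true {eqb i u} it)))
    (inj₂ (inj₂ j)) it _ → contradiction refl (neq⇒≢ (proj₁ (∧-true {neq i u} it)))
  ... | no i≢u = inj₂ (inj₂ (w i)) , λ where
    (inj₁ _)        _  ()
    (inj₂ (inj₁ j)) it _ → contradiction (eqb⇒≡ (proj₁ (∧-true {eqb i u} it))) i≢u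
    (inj₂ (inj₂ j)) it _ → cong (inj₂ ∘ inj₂) (sym (eqb⇒≡ (proj₂ (∧-true {neq i u} it))))

  one-neighbour-outside-A : ∀ {x} → isA x ≡ true →
    ∃[ e ] ∀ y → Adj G x y → isA y ≡ false → y ≡ e
  one-neighbour-outside-A {x} Ax with part x
  ... | inj₁ i with outer-neighbour-unique i
  ...   | e , only-e = fromPart e , λ y xy Ay → part⇒≡ (only-e (part y) xy Ay)

  module _ {T : Graph (a + (b + d))} (simple : IsSimple T)
           (T⊆G : ∀ x y → Adj T x y → Adj G x y) (connected : Connected T) where

    2≤degree-U : 2 ≤ degree T U
    2≤degree-U = subst (λ s → 2 ≤ degree T s) s≡U (crossing-source-2≤degree simple c s≢W)
      where
      c : Crossing T isB W
      c = first-crossing isB (connected W V) (cong inB part-W) (cong inB part-V)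
      open Crossing c
      s≡U : source ≡ U
      s≡U = proj₂ (edge-leaving-B (T⊆G target source (adj-sym simple edge)) target∈P source∉P)
      s≢W : source ≢ W
      s≢W s≡W with trans (sym part-W) (trans (cong part (trans (sym s≡W) s≡U)) part-U)
      ... | ()

    second-branch-vertex : ∃[ s ] isA s ≡ true × s ≢ U × 2 ≤ degree T s
    second-branch-vertex =
      source , proj₁ As×s≢U , proj₂ As×s≢U , crossing-source-2≤degree simple c s≢V
      where
      c : Crossing T isD V
      c = first-crossing isD (connected V W) (cong inD part-V) (cong inD part-W)
      open Crossing c
      As×s≢U : isA source ≡ true × source ≢ U
      As×s≢U = edge-entering-D (T⊆G source target edge) source∉P target∈P
      s≢V : source ≢ V
      s≢V s≡V with trans (sym (proj₁ As×s≢U)) (trans (cong isA s≡V) (cong inA part-V))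
      ... | ()

    no-[2,k]-spanning-tree : Acyclic T → ∀ {k} → a < k + k →
      (∀ x → 2 ≤ degree T x → suc k ≤ degree T x) → ⊥
    no-[2,k]-spanning-tree acyclic {k} a<2k large with second-branch-vertex
    ... | s , As , s≢U , 2≤degree-s =
      no-two-dense-vertices simple acyclic isA (subst (_< k + k) (sym count-A) a<2k)
        (s≢U ∘ sym) AU (dense AU (large U 2≤degree-U)) (dense As (large s 2≤degree-s))
      where
      AU : isA U ≡ true
      AU = cong inA part-U
      dense : ∀ {x} → isA x ≡ true → suc k ≤ degree T x → k ≤ count (λ z → T x z ∧ isA z)
      dense Ax = many-neighbours-inside T⊆G isA (proj₂ (one-neighbour-outside-A Ax))

sizeA<k+k : ∀ k → 1 ≤ k → sizeA k < k + k
sizeA<k+k (suc k) _ = s≤s (≤-reflexive (cong (k +_) (+-identityʳ (suc k))))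

avoiding-[2,k]⇒large : ∀ {k d} → ¬ (2 ≤ d × d ≤ k) → 2 ≤ d → suc k ≤ d
avoiding-[2,k]⇒large {k} {d} avoids 2≤d with d ≤? k
... | yes d≤k = contradiction (2≤d , d≤k) avoids
... | no  d≰k = ≰⇒> d≰k

lemma2p1 : (k n : ℕ) → 2 ≤ k → 6 * k ≤ n →
    (u : Fin (sizeA k)) (v : Fin (sizeB n k)) (w : Fin (sizeA k) → Fin (sizeD n k)) →
    ¬ Has2kST k (H k n u v w)
lemma2p1 k n 2≤k _ u v w (T , ((simple , T⊆H , connected , acyclic) , avoids)) =
  StructureOfH.no-[2,k]-spanning-tree u v w simple T⊆H connected acyclic
    (sizeA<k+k k (≤-trans (s≤s z≤n) 2≤k)) (λ x → avoiding-[2,k]⇒large (avoids x))
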